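{- Let $T$ be a tree rooted in some vertex $r$, and let $w:V(T)\to \mathbb{Z}_{\geq 0}$. Let $W$ and $\partial W$ be positive integers. Let $S_0$ be the set of vertices of $T$ consisting of $r$ and all vertices $u$ of $T$ such that the subtree of $T$ containing $u$ and all descendants of $u$ has $w$-weight more than $W$. Let $L$ be the set of vertices $u\in V(T)\setminus S_0$ with $w(u)>\partial W$. Then there is a set $S$ of vertices of $T$ such that $W\leq w(S)\leq W+\partial W$, $r\in S$, $T[S]$ is connected, and $w(D)\leq W$ for every component $D$ of $T-S$, if and only if there is a subset $L'$ of $L$ such that (i) $|L'|<\frac{W+\partial W}{\partial W}$, (ii) the smallest subtree $T'$ of $T$ that contains $S_0\cup L'$ satisfies $w(T')\leq W+\partial W$ and $L'=L\cap V(T')$, and (iii) the component $T''$ of $T-(L\setminus L')$ that contains $r$ satisfies $w(T'')\geq W$.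
   Context: For a set $U\subseteq V(T)$ and a subgraph $H$ of $T$, $w(U)=\sum_{u\in U}w(u)$ and $w(H)=w(V(H))$. $T[S]$ denotes the subgraph induced by $S$, and $T-X$ denotes the subgraph induced by $V(T)\setminus X$. -}

module Defs where

open import Data.Nat using (ℕ; zero; suc; _+_; _*_; _≤_; _<_)
open import Data.Fin using (Fin; zero; suc)
open import Data.Bool using (Bool; true; false; if_then_else_; _∧_; not)
open import Data.Product using (Σ; ∃; _×_; _,_)
open import Data.Sum using (_⊎_)
open import Relation.Binary.PropositionalEquality using (_≡_; _≢_)
open import Function.Bundles using (_⇔_)

-- A rooted tree on the vertex set Fin n, encoded by its parent map:
-- the root is its own "parent", and every vertex reaches the root by
-- iterating the parent map.  The edges are {v , parent v} for v ≢ root.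
iter : ∀ {n} → (Fin n → Fin n) → ℕ → Fin n → Fin n
iter f zero    v = v
iter f (suc k) v = f (iter f k v)

record RootedTree (n : ℕ) : Set where
  field
    parent      : Fin n → Fin n
    root        : Fin n
    parent-root : parent root ≡ root
    reaches     : ∀ v → ∃ λ k → iter parent k v ≡ root
open RootedTree public

Adj : ∀ {n} → RootedTree n → Fin n → Fin n → Set
Adj T u v = (u ≢ v) × ((parent T u ≡ v) ⊎ (parent T v ≡ u))

Sub : ℕ → Set
Sub n = Fin n → Bool

_∈_ : ∀ {n} → Fin n → Sub n → Set
u ∈ X = X u ≡ true

_∉_ : ∀ {n} → Fin n → Sub n → Set
u ∉ X = X u ≡ false

_⊆_ : ∀ {n} → Sub n → Sub n → Set
X ⊆ Y = ∀ u → u ∈ X → u ∈ Y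

_∪_ : ∀ {n} → Sub n → Sub n → Sub n
(X ∪ Y) u = if X u then true else Y u

_∖_ : ∀ {n} → Sub n → Sub n → Sub n
(X ∖ Y) u = X u ∧ not (Y u)

complement : ∀ {n} → Sub n → Sub n
complement X u = not (X u)

∑ : ∀ {n} → (Fin n → ℕ) → ℕ
∑ {zero}  f = 0
∑ {suc n} f = f zero + ∑ (λ i → f (suc i))

wt : ∀ {n} → (Fin n → ℕ) → Sub n → ℕ
wt w U = ∑ (λ v → if U v then w v else 0)

card : ∀ {n} → Sub n → ℕ
card U = wt (λ _ → 1) U

Desc : ∀ {n} → RootedTree n → Fin n → Fin n → Set
Desc T u v = ∃ λ k → iter (parent T) k v ≡ u

IsSubtreeAt : ∀ {n} → RootedTree n → Fin n → Sub n → Set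
IsSubtreeAt T u D = ∀ v → (v ∈ D) ⇔ Desc T u v

data Reach {n} (T : RootedTree n) (X : Sub n) (a : Fin n) : Fin n → Set where
  here : a ∈ X → Reach T X a a
  step : ∀ {b c} → Reach T X a b → Adj T b c → c ∈ X → Reach T X a c

Connected : ∀ {n} → RootedTree n → Sub n → Set
Connected T X = ∀ a b → a ∈ X → b ∈ X → Reach T X a b

IsComponentOf : ∀ {n} → RootedTree n → Sub n → Fin n → Sub n → Set
IsComponentOf T X v D = ∀ u → (u ∈ D) ⇔ Reach T X v u

IsSmallestSubtree : ∀ {n} → RootedTree n → Sub n → Sub n → Set
IsSmallestSubtree T A X =
  (A ⊆ X) × Connected T X × (∀ Y → A ⊆ Y → Connected T Y → X ⊆ Y)

IsS0 : ∀ {n} → RootedTree n → (Fin n → ℕ) → ℕ → Sub n → Set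
IsS0 T w W S0 = ∀ u → (u ∈ S0) ⇔
  ((u ≡ root T) ⊎ (∀ D → IsSubtreeAt T u D → W < wt w D))

IsL : ∀ {n} → (Fin n → ℕ) → ℕ → Sub n → Sub n → Set
IsL w ∂W S0 L = ∀ u → (u ∈ L) ⇔ ((u ∉ S0) × (∂W < w u))

GoodS : ∀ {n} → RootedTree n → (Fin n → ℕ) → ℕ → ℕ → Sub n → Set
GoodS T w W ∂W S =
  (W ≤ wt w S) × (wt w S ≤ W + ∂W) × (root T ∈ S) × Connected T S ×
  (∀ v D → v ∉ S → IsComponentOf T (complement S) v D → wt w D ≤ W)

-- right-hand side: a good L' ⊆ L exists
-- (|L'| < (W+∂W)/∂W is written as |L'|·∂W < W+∂W)
GoodL' : ∀ {n : ℕ} → RootedTree n → (Fin n → ℕ) → ℕ → ℕ → Sub n → Sub n → Sub n → Set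
GoodL' {n} T w W ∂W S0 L L' =
  (L' ⊆ L) ×
  (card L' * ∂W < W + ∂W) ×
  (Σ (Sub n) λ T' → IsSmallestSubtree T (S0 ∪ L') T' ×
      (wt w T' ≤ W + ∂W) × (∀ u → (u ∈ L') ⇔ ((u ∈ L) × (u ∈ T')))) ×
  (Σ (Sub n) λ T'' → IsComponentOf T (complement (L ∖ L')) (root T) T'' ×
      (W ≤ wt w T''))

module Submission where

-- Two structural facts about T drive the proof.  (1) A vertex set containing r is
-- connected iff it is closed under taking ancestors.  (2) If S is such a set, every
-- component of T − S is the full subtree below a vertex t ∉ S whose parent lies in S.
-- From (2): for a connected S ∋ r, all components of T − S weigh at most W iff S0 ⊆ S.
--
-- (⇒) Given S, put L' = L ∩ S.  The smallest subtree T' containing S0 ∪ L' is the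
-- ancestor closure of that set, hence lies inside S; this bounds w(T') and, as every
-- vertex of L' weighs more than ∂W, also |L'|·(∂W+1) ≤ w(S) ≤ W + ∂W.  Since S avoids
-- L ∖ L' and is connected, it lies in the root component T'' of T − (L ∖ L').
-- (⇐) Grow T' greedily: while the current connected set X weighs less than W, some
-- vertex of T'' is missing, and the topmost missing vertex t above it lies in T'' but
-- outside S0 ∪ L, so w(t) ≤ ∂W and X ∪ {t} stays connected of weight ≤ W + ∂W.
-- The final set contains S0, so by the characterisation above it is a solution.

open import Defs
open import Data.Nat using (ℕ; zero; suc; _+_; _*_; _∸_; _≤_; _<_; z≤n; s≤s; _≤?_; _<?_)
open import Data.Nat.Properties
open import Data.Fin using (Fin; zero; suc; toℕ; fromℕ; fromℕ<)
open import Data.Fin.Properties using (any?; all?; toℕ-fromℕ; toℕ-fromℕ<) renaming (_≟_ to _≟ᶠ_)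
open import Data.Bool using (true; false; if_then_else_; _∧_; not)
open import Data.Bool.Properties using (∧-conicalˡ; ∧-conicalʳ; not-¬; ¬-not) renaming (_≟_ to _≟ᵇ_)
open import Data.Product using (Σ; ∃; _×_; _,_; proj₁; proj₂)
open import Data.Sum using (_⊎_; inj₁; inj₂)
open import Data.Empty using (⊥; ⊥-elim)
open import Relation.Nullary using (¬_; Dec; yes; no; does; contradiction)
open import Relation.Nullary.Decidable using (map′; dec-true; _×-dec_; _→-dec_)
open import Relation.Binary.PropositionalEquality
open import Function.Bundles using (_⇔_; mk⇔; Equivalence)
open import Algebra.Properties.CommutativeSemigroup +-commutativeSemigroup using (x∙yz≈y∙xz)

open Equivalence using (to; from)

∈-∉ : ∀ {b} → b ≡ true → b ≡ false → ⊥
∈-∉ = not-¬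

∈-by-contra : ∀ {b} → b ≢ false → b ≡ true
∈-by-contra = ¬-not

∉-by-contra : ∀ {b} → b ≢ true → b ≡ false
∉-by-contra = ¬-not

∈complement⁻ : ∀ {b} → not b ≡ true → b ≡ false
∈complement⁻ {false} _ = refl

module _ {n : ℕ} where

  setOf : {Q : Fin n → Set} → (∀ u → Dec (Q u)) → Sub n
  setOf Q? u = does (Q? u)

  ∈setOf⁻ : {Q : Fin n → Set} (Q? : ∀ u → Dec (Q u)) {u : Fin n} → u ∈ setOf Q? → Q u
  ∈setOf⁻ Q? {u} h with Q? u
  ∈setOf⁻ Q? {u} h  | yes q = q
  ∈setOf⁻ Q? {u} () | no _

  ∈setOf⁺ : {Q : Fin n → Set} (Q? : ∀ u → Dec (Q u)) {u : Fin n} → Q u → u ∈ setOf Q?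
  ∈setOf⁺ Q? {u} = dec-true (Q? u)

  ⁅_⁆ : Fin n → Sub n
  ⁅ t ⁆ = setOf (_≟ᶠ t)

  _∩_ : Sub n → Sub n → Sub n
  (X ∩ Y) u = X u ∧ Y u

  ∪-inj₁ : ∀ (X Y : Sub n) {u} → u ∈ X → u ∈ (X ∪ Y)
  ∪-inj₁ X Y {u} h rewrite h = refl

  ∪-inj₂ : ∀ (X Y : Sub n) {u} → u ∈ Y → u ∈ (X ∪ Y)
  ∪-inj₂ X Y {u} h with X u
  ... | true  = refl
  ... | false = h

  ∪-cases : ∀ (X Y : Sub n) {u} → u ∈ (X ∪ Y) → u ∈ X ⊎ u ∈ Y
  ∪-cases X Y {u} h with X u
  ... | true  = inj₁ refl
  ... | false = inj₂ h

  ∩-intro : ∀ (X Y : Sub n) {u} → u ∈ X → u ∈ Y → u ∈ (X ∩ Y)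
  ∩-intro X Y {u} p q rewrite p | q = refl

  ∩-elim : ∀ (X Y : Sub n) {u} → u ∈ (X ∩ Y) → u ∈ X × u ∈ Y
  ∩-elim X Y {u} h = ∧-conicalˡ (X u) (Y u) h , ∧-conicalʳ (X u) (Y u) h

  ∖-avoid⁺ : ∀ (X Y : Sub n) {u} → (u ∈ X → u ∈ Y) → u ∈ complement (X ∖ Y)
  ∖-avoid⁺ X Y {u} h with X u | Y u
  ... | false | _    = refl
  ... | true  | true = refl
  ... | true  | false with () ← h refl

  ∖-avoid⁻ : ∀ (X Y : Sub n) {u} → u ∈ complement (X ∖ Y) → u ∈ X → u ∈ Y
  ∖-avoid⁻ X Y {u} h p with X u | Y u
  ∖-avoid⁻ X Y {u} h  refl | true | true  = refl
  ∖-avoid⁻ X Y {u} () refl | true | false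

∑-cong : ∀ {n} {f g : Fin n → ℕ} → (∀ i → f i ≡ g i) → ∑ f ≡ ∑ g
∑-cong {zero}  h = refl
∑-cong {suc n} h = cong₂ _+_ (h zero) (∑-cong (λ i → h (suc i)))

∑-mono : ∀ {n} {f g : Fin n → ℕ} → (∀ i → f i ≤ g i) → ∑ f ≤ ∑ g
∑-mono {zero}  h = z≤n
∑-mono {suc n} h = +-mono-≤ (h zero) (∑-mono (λ i → h (suc i)))

∑-*ʳ : ∀ {n} (f : Fin n → ℕ) k → ∑ f * k ≡ ∑ (λ i → f i * k)
∑-*ʳ {zero}  f k = refl
∑-*ʳ {suc n} f k =
  trans (*-distribʳ-+ k (f zero) (∑ (λ i → f (suc i)))) (cong (f zero * k +_) (∑-*ʳ (λ i → f (suc i)) k))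

∑-const1 : ∀ n → ∑ {n} (λ _ → 1) ≡ n
∑-const1 zero    = refl
∑-const1 (suc n) = cong suc (∑-const1 n)

module _ {n : ℕ} (w : Fin n → ℕ) where

  wt-unique : ∀ {Q : Fin n → Set} {X Y : Sub n} → (∀ u → (u ∈ X) ⇔ Q u) → (∀ u → (u ∈ Y) ⇔ Q u) →
              wt w X ≡ wt w Y
  wt-unique {X = X} {Y} dX dY = ∑-cong (λ u → cong (λ b → if b then w u else 0) (agree u))
    where
      agree : ∀ u → X u ≡ Y u
      agree u with X u in ex | Y u in ey
      ... | true  | true  = refl
      ... | false | false = refl
      ... | true  | false = ⊥-elim (∈-∉ (from (dY u) (to (dX u) ex)) ey)
      ... | false | true  = ⊥-elim (∈-∉ (from (dX u) (to (dY u) ey)) ex)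

  wt-mono : ∀ {X Y : Sub n} → X ⊆ Y → wt w X ≤ wt w Y
  wt-mono {X} {Y} X⊆Y = ∑-mono pointwise
    where
      pointwise : ∀ u → (if X u then w u else 0) ≤ (if Y u then w u else 0)
      pointwise u with X u in ex
      ... | false = z≤n
      ... | true rewrite X⊆Y u ex = ≤-refl

  wt-insert : ∀ (X : Sub n) t → t ∉ X → wt w (⁅ t ⁆ ∪ X) ≡ w t + wt w X
  wt-insert = go w
    where
      go : ∀ {m} (w : Fin m → ℕ) (X : Sub m) t → t ∉ X → wt w (⁅ t ⁆ ∪ X) ≡ w t + wt w X
      go w X zero t∉X rewrite t∉X = refl
      go w X (suc t) t∉X = begin
          x₀ + wt w′ (⁅ t ⁆ ∪ X′)  ≡⟨ cong (x₀ +_) (go w′ X′ t t∉X) ⟩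
          x₀ + (w′ t + wt w′ X′)   ≡⟨ x∙yz≈y∙xz x₀ (w′ t) (wt w′ X′) ⟩
          w′ t + (x₀ + wt w′ X′)   ∎
        where
          open ≡-Reasoning
          w′ = λ i → w (suc i)
          X′ = λ i → X (suc i)
          x₀ = if X zero then w zero else 0

  extra-vertex : ∀ (X Y : Sub n) → wt w X < wt w Y → ∃ λ z → z ∈ Y × z ∉ X
  extra-vertex X Y lt with any? (λ z → (Y z ≟ᵇ true) ×-dec (X z ≟ᵇ false))
  ... | yes found = found
  ... | no none   = contradiction (wt-mono Y⊆X) (<⇒≱ lt)
    where
      Y⊆X : Y ⊆ X
      Y⊆X z z∈Y = ∈-by-contra (λ z∉X → none (z , z∈Y , z∉X))

  card-* : ∀ (U : Sub n) k → (∀ u → u ∈ U → k ≤ w u) → card U * k ≤ wt w U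
  card-* U k heavy = subst (_≤ wt w U) (sym (∑-*ʳ (λ u → if U u then 1 else 0) k)) (∑-mono pointwise)
    where
      pointwise : ∀ u → (if U u then 1 else 0) * k ≤ (if U u then w u else 0)
      pointwise u with U u in eu
      ... | false = z≤n
      ... | true  = subst (_≤ w u) (sym (+-identityʳ k)) (heavy u eu)

card-≤ : ∀ {n} (X : Sub n) → card X ≤ n
card-≤ {n} X = subst (card X ≤_) (∑-const1 n) (∑-mono pointwise)
  where
    pointwise : ∀ u → (if X u then 1 else 0) ≤ 1
    pointwise u with X u
    ... | true  = ≤-refl
    ... | false = z≤n

-- The numerical form of |L'| < (W + ∂W)/∂W used in the statement.
count-bound : ∀ c d M → 0 < M → c * suc d ≤ M → c * d < M
count-bound zero    d M 0<M _ = 0<M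
count-bound (suc c) d M _   h = ≤-trans (s≤s (m≤n+m (suc c * d) c)) (subst (_≤ M) (*-suc (suc c) d) h)

iter-+ : ∀ {n} (f : Fin n → Fin n) m k v → iter f (m + k) v ≡ iter f m (iter f k v)
iter-+ f zero    k v = refl
iter-+ f (suc m) k v = cong f (iter-+ f m k v)

iter-suc : ∀ {n} (f : Fin n → Fin n) k v → iter f (suc k) v ≡ iter f k (f v)
iter-suc f zero    v = refl
iter-suc f (suc k) v = cong f (iter-suc f k v)

iter-fixed : ∀ {n} (f : Fin n → Fin n) {r} → f r ≡ r → ∀ k → iter f k r ≡ r
iter-fixed f e zero    = refl
iter-fixed f e (suc k) = trans (cong f (iter-fixed f e k)) e

module _ {n} (T : RootedTree n) where
  private
    P = parent T
    r = root T

  depth : Fin n → ℕ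
  depth v = proj₁ (reaches T v)

  iter-beyond : ∀ v {j} → depth v ≤ j → iter P j v ≡ r
  iter-beyond v {j} d≤j = begin
      iter P j v                  ≡⟨ cong (λ m → iter P m v) (sym (m∸n+n≡m d≤j)) ⟩
      iter P (e + depth v) v      ≡⟨ iter-+ P e (depth v) v ⟩
      iter P e (iter P (depth v) v) ≡⟨ cong (iter P e) (proj₂ (reaches T v)) ⟩
      iter P e r                  ≡⟨ iter-fixed P (parent-root T) e ⟩
      r                           ∎
    where
      open ≡-Reasoning
      e = j ∸ depth v

  desc-root : ∀ {a} → Desc T a r → a ≡ r
  desc-root (k , e) = trans (sym e) (iter-fixed P (parent-root T) k)

  desc-trans : ∀ {a b c} → Desc T a b → Desc T b c → Desc T a c
  desc-trans {c = c} (k , e) (j , e′) = k + j , trans (iter-+ P k j c) (trans (cong (iter P k) e′) e)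

  parent-step : ∀ {v b} → Desc T v b → (b ≡ v) ⊎ Desc T v (P b)
  parent-step (zero  , b≡v) = inj₁ b≡v
  parent-step {b = b} (suc j , e) = inj₂ (j , trans (sym (iter-suc P j b)) e)

  -- Every ancestor of v is reached within depth v steps, so ancestry is decidable.
  desc-bounded : ∀ {a v} → Desc T a v → ∃ λ (i : Fin (suc (depth v))) → iter P (toℕ i) v ≡ a
  desc-bounded {a} {v} (j , e) with j <? suc (depth v)
  ... | yes j< = fromℕ< j< , subst (λ m → iter P m v ≡ a) (sym (toℕ-fromℕ< j<)) e
  ... | no  j≮ = fromℕ (depth v) , (begin
        iter P (toℕ (fromℕ (depth v))) v ≡⟨ cong (λ m → iter P m v) (toℕ-fromℕ (depth v)) ⟩
        iter P (depth v) v               ≡⟨ proj₂ (reaches T v) ⟩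
        r                                ≡⟨ sym (iter-beyond v (≤-trans (n≤1+n _) (≮⇒≥ j≮))) ⟩
        iter P j v                       ≡⟨ e ⟩
        a                                ∎)
    where open ≡-Reasoning

  desc? : ∀ a v → Dec (Desc T a v)
  desc? a v = map′ (λ (i , e) → toℕ i , e) desc-bounded (any? (λ i → iter P (toℕ i) v ≟ᶠ a))

  below-ancestor : ∀ {t x k} → iter P k x ≡ t → ∀ j → j ≤ k → Desc T t (iter P j x)
  below-ancestor {x = x} {k} e j j≤k =
    k ∸ j , trans (sym (iter-+ P (k ∸ j) j x)) (trans (cong (λ m → iter P m x) (m∸n+n≡m j≤k)) e)

  adj-sym : ∀ {a b} → Adj T a b → Adj T b a
  adj-sym (a≢b , inj₁ e) = (λ b≡a → a≢b (sym b≡a)) , inj₂ e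
  adj-sym (a≢b , inj₂ e) = (λ b≡a → a≢b (sym b≡a)) , inj₁ e

  reach-start : ∀ {X a b} → Reach T X a b → a ∈ X
  reach-start (here a∈X)     = a∈X
  reach-start (step p _ _)   = reach-start p

  reach-end : ∀ {X a b} → Reach T X a b → b ∈ X
  reach-end (here a∈X)     = a∈X
  reach-end (step _ _ c∈X) = c∈X

  reach-trans : ∀ {X a b c} → Reach T X a b → Reach T X b c → Reach T X a c
  reach-trans p (here _)       = p
  reach-trans p (step q e c∈X) = step (reach-trans p q) e c∈X

  reach-sym : ∀ {X a b} → Reach T X a b → Reach T X b a
  reach-sym (here a∈X)     = here a∈X
  reach-sym (step p e c∈X) = reach-trans (step (here c∈X) (adj-sym e) (reach-end p)) (reach-sym p)

  reach-mono : ∀ {X Y a b} → X ⊆ Y → Reach T X a b → Reach T Y a b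
  reach-mono X⊆Y (here a∈X)     = here (X⊆Y _ a∈X)
  reach-mono X⊆Y (step p e c∈X) = step (reach-mono X⊆Y p) e (X⊆Y _ c∈X)

  climb : ∀ X x k → (∀ j → j ≤ k → iter P j x ∈ X) → Reach T X x (iter P k x)
  climb X x zero    inX = here (inX 0 z≤n)
  climb X x (suc k) inX
    with climb X x k (λ j j≤k → inX j (≤-trans j≤k (n≤1+n k))) | iter P k x ≟ᶠ P (iter P k x)
  ... | p | yes same = subst (Reach T X x) same p
  ... | p | no  diff = step p (diff , inj₁ refl) (inX (suc k) ≤-refl)

  climb-to-root : ∀ X v → (∀ a → Desc T a v → a ∈ X) → Reach T X v r
  climb-to-root X v anc =
    subst (Reach T X v) (proj₂ (reaches T v)) (climb X v (depth v) (λ j _ → anc (iter P j v) (j , refl)))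

  leave-subtree : ∀ {Y x y} v → Reach T Y x y → Desc T v x → ¬ Desc T v y → (v ∈ Y) × (P v ∈ Y)
  leave-subtree v (here _) v≤x v≰y = contradiction v≤x v≰y
  leave-subtree {Y} v (step {b} {c} p e c∈Y) v≤x v≰c with desc? v b
  ... | no v≰b = leave-subtree v p v≤x v≰b
  ... | yes v≤b with e
  ...   | (_ , inj₂ Pc≡b) = contradiction (desc-trans v≤b (1 , Pc≡b)) v≰c
  ...   | (_ , inj₁ Pb≡c) with parent-step v≤b
  ...     | inj₂ v≤Pb = contradiction (subst (Desc T v) Pb≡c v≤Pb) v≰c
  ...     | inj₁ b≡v  = subst (_∈ Y) b≡v (reach-end p) , subst (_∈ Y) (trans (sym Pb≡c) (cong P b≡v)) c∈Y

  root-path-ancestors : ∀ {X u a} → Reach T X r u → Desc T a u → a ∈ X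
  root-path-ancestors {X} {a = a} p a≤u with a ≟ᶠ r
  ... | yes a≡r = subst (_∈ X) (sym a≡r) (reach-start p)
  ... | no  a≢r = proj₁ (leave-subtree a (reach-sym p) a≤u (λ a≤r → a≢r (desc-root a≤r)))

  UpClosed : Sub n → Set
  UpClosed X = ∀ {a u} → u ∈ X → Desc T a u → a ∈ X

  connected⇒upClosed : ∀ {X} → r ∈ X → Connected T X → UpClosed X
  connected⇒upClosed r∈X con {u = u} u∈X = root-path-ancestors (con r u r∈X u∈X)

  upClosed⇒connected : ∀ {X} → UpClosed X → Connected T X
  upClosed⇒connected {X} up a b a∈X b∈X =
    reach-trans (to-root a∈X) (reach-sym (to-root b∈X))
    where
      to-root : ∀ {v} → v ∈ X → Reach T X v r
      to-root {v} v∈X = climb-to-root X v (λ a a≤v → up v∈X a≤v)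

  insert-connected : ∀ {X t} → Connected T X → t ∉ X → P t ∈ X → Connected T (⁅ t ⁆ ∪ X)
  insert-connected {X} {t} con t∉X Pt∈X a b a∈ b∈ =
    reach-trans (to-parent a∈) (reach-sym (to-parent b∈))
    where
      old : X ⊆ (⁅ t ⁆ ∪ X)
      old u = ∪-inj₂ ⁅ t ⁆ X
      t~Pt : Adj T t (P t)
      t~Pt = (λ t≡Pt → ∈-∉ (subst (_∈ X) (sym t≡Pt) Pt∈X) t∉X) , inj₁ refl
      to-parent : ∀ {a} → a ∈ (⁅ t ⁆ ∪ X) → Reach T (⁅ t ⁆ ∪ X) a (P t)
      to-parent {a} a∈ with ∪-cases ⁅ t ⁆ X a∈
      ... | inj₂ a∈X = reach-mono old (con a (P t) a∈X Pt∈X)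
      ... | inj₁ a∈t with ∈setOf⁻ (_≟ᶠ t) {a} a∈t
      ...   | refl = step (here a∈) t~Pt (old _ Pt∈X)

  subtree : Fin n → Sub n
  subtree t = setOf (desc? t)

  subtree-isSubtree : ∀ t → IsSubtreeAt T t (subtree t)
  subtree-isSubtree t v = mk⇔ (∈setOf⁻ (desc? t)) (∈setOf⁺ (desc? t))

  subtree-mono : ∀ {t u} → Desc T t u → subtree u ⊆ subtree t
  subtree-mono {t} {u} t≤u v v∈ = ∈setOf⁺ (desc? t) (desc-trans t≤u (∈setOf⁻ (desc? u) v∈))

  topmost-outside : ∀ (S : Sub n) → r ∈ S → ∀ {x} → x ∉ S →
                    Σ (Fin n) λ t → (t ∉ S) × (P t ∈ S) × Desc T t x
  topmost-outside S r∈S {x} x∉S = go (depth x) x (subst (_∈ S) (sym (proj₂ (reaches T x))) r∈S) x∉S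
    where
      -- Pᵏ x ∈ S: walk up from x until the parent is in S
      go : ∀ k x → iter P k x ∈ S → x ∉ S → Σ (Fin n) λ t → (t ∉ S) × (P t ∈ S) × Desc T t x
      go zero    x inS x∉S = ⊥-elim (∈-∉ inS x∉S)
      go (suc k) x inS x∉S with S (P x) in e
      ... | true  = x , x∉S , e , (0 , refl)
      ... | false with go k (P x) (subst (_∈ S) (iter-suc P k x) inS) e
      ...   | t , t∉S , Pt∈S , (j , d) = t , t∉S , Pt∈S , (suc j , trans (iter-suc P j x) d)

  subtree-component : ∀ {S} → r ∈ S → Connected T S → ∀ {t} → t ∉ S → P t ∈ S →
                      ∀ {v} → Desc T t v → IsComponentOf T (complement S) v (subtree t)
  subtree-component {S} r∈S con {t} t∉S Pt∈S {v} t≤v u = mk⇔ inside leaving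
    where
      outside : ∀ {x} → Desc T t x → x ∈ complement S
      outside {x} t≤x with S x in e
      ... | true  = ⊥-elim (∈-∉ (connected⇒upClosed r∈S con e t≤x) t∉S)
      ... | false = refl
      up-to-t : ∀ {x} → Desc T t x → Reach T (complement S) x t
      up-to-t {x} (k , e) = subst (Reach T (complement S) x) e
        (climb (complement S) x k (λ j j≤k → outside (below-ancestor e j j≤k)))
      inside : u ∈ subtree t → Reach T (complement S) v u
      inside u∈ = reach-trans (up-to-t t≤v) (reach-sym (up-to-t (∈setOf⁻ (desc? t) u∈)))
      leaving : Reach T (complement S) v u → u ∈ subtree t
      leaving p with desc? t u
      ... | yes t≤u = ∈setOf⁺ (desc? t) t≤u
      ... | no  t≰u = ⊥-elim (∈-∉ Pt∈S (∈complement⁻ (proj₂ (leave-subtree t p t≤v t≰u))))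

  upClosure : Sub n → Sub n
  upClosure A = setOf (λ v → any? (λ a → (A a ≟ᵇ true) ×-dec desc? v a))

  upClosure-smallest : ∀ {A} → r ∈ A → IsSmallestSubtree T A (upClosure A)
  upClosure-smallest {A} r∈A = A⊆ , upClosed⇒connected up , least
    where
      Q? = λ v → any? (λ a → (A a ≟ᵇ true) ×-dec desc? v a)
      A⊆ : A ⊆ upClosure A
      A⊆ a a∈A = ∈setOf⁺ Q? (a , a∈A , (0 , refl))
      up : UpClosed (upClosure A)
      up u∈ a≤u with ∈setOf⁻ Q? u∈
      ... | b , b∈A , u≤b = ∈setOf⁺ Q? (b , b∈A , desc-trans a≤u u≤b)
      least : ∀ Y → A ⊆ Y → Connected T Y → upClosure A ⊆ Y
      least Y A⊆Y con v v∈ with ∈setOf⁻ Q? v∈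
      ... | a , a∈A , v≤a = connected⇒upClosed (A⊆Y r r∈A) con (A⊆Y a a∈A) v≤a

  rootComponent : Sub n → Sub n
  rootComponent X = setOf (λ u → all? (λ a → desc? a u →-dec (X a ≟ᵇ true)))

  rootComponent-isComponent : ∀ {X} → r ∈ X → IsComponentOf T X r (rootComponent X)
  rootComponent-isComponent {X} r∈X u =
    mk⇔ (λ u∈ → reach-sym (climb-to-root X u (∈setOf⁻ Q? u∈)))
        (λ p → ∈setOf⁺ Q? (λ a a≤u → root-path-ancestors p a≤u))
    where Q? = λ u → all? (λ a → desc? a u →-dec (X a ≟ᵇ true))

module _ {n} (T : RootedTree n) (w : Fin n → ℕ) (W : ℕ) {S0 : Sub n} (hS0 : IsS0 T w W S0) where
  private
    r = root T

  LightComplement : Sub n → Set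
  LightComplement S = ∀ v D → v ∉ S → IsComponentOf T (complement S) v D → wt w D ≤ W

  root∈S0 : r ∈ S0
  root∈S0 = from (hS0 r) (inj₁ refl)

  heavy⇔ : ∀ u → (W < wt w (subtree T u)) ⇔ (∀ D → IsSubtreeAt T u D → W < wt w D)
  heavy⇔ u = mk⇔ (λ h D sub → subst (W <_) (wt-unique w (subtree-isSubtree T u) sub) h)
                 (λ h → h (subtree T u) (subtree-isSubtree T u))

  light⇒S0⊆ : ∀ {S} → r ∈ S → Connected T S → LightComplement S → S0 ⊆ S
  light⇒S0⊆ {S} r∈S con light u u∈S0 = ∈-by-contra excluded
    where
      excluded : ¬ u ∉ S
      excluded u∉S with to (hS0 u) u∈S0 | topmost-outside T S r∈S u∉S
      ... | inj₁ u≡r   | _ = ∈-∉ (subst (_∈ S) (sym u≡r) r∈S) u∉S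
      ... | inj₂ heavy | t , t∉S , Pt∈S , t≤u = <⇒≱ (from (heavy⇔ u) heavy) (begin
          wt w (subtree T u) ≤⟨ wt-mono w (subtree-mono T t≤u) ⟩
          wt w (subtree T t) ≤⟨ light t (subtree T t) t∉S (subtree-component T r∈S con t∉S Pt∈S (0 , refl)) ⟩
          W                  ∎)
        where open ≤-Reasoning

  S0⊆⇒light : ∀ {S} → r ∈ S → Connected T S → S0 ⊆ S → LightComplement S
  S0⊆⇒light {S} r∈S con S0⊆S v D v∉S comp with topmost-outside T S r∈S v∉S
  ... | t , t∉S , Pt∈S , t≤v = begin
      wt w D              ≡⟨ wt-unique w comp (subtree-component T r∈S con t∉S Pt∈S t≤v) ⟩
      wt w (subtree T t)  ≤⟨ ≮⇒≥ t-not-heavy ⟩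
      W                   ∎
    where
      open ≤-Reasoning
      t-not-heavy : ¬ W < wt w (subtree T t)
      t-not-heavy heavy = ∈-∉ (S0⊆S t (from (hS0 t) (inj₂ (to (heavy⇔ t) heavy)))) t∉S

-- If every set satisfying Inv and lighter than W can be enlarged by one vertex within
-- Inv, then (since a set has at most n vertices) some set satisfying Inv weighs ≥ W.
grow : ∀ {n} (w : Fin n → ℕ) (W : ℕ) (Inv : Sub n → Set) →
       (∀ X → Inv X → wt w X < W → Σ (Sub n) λ X′ → Inv X′ × card X′ ≡ suc (card X)) →
       ∀ X → Inv X → Σ (Sub n) λ S → Inv S × W ≤ wt w S
grow {n} w W Inv extend X inv = go n X inv (m≤n+m n (card X))
  where
    -- n ≤ card X + fuel: fuel bounds the number of further enlargements
    go : ∀ fuel X → Inv X → n ≤ card X + fuel → Σ (Sub n) λ S → Inv S × W ≤ wt w S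
    go fuel X inv room with W ≤? wt w X
    ... | yes W≤ = X , inv , W≤
    ... | no  W≰ with extend X inv (≰⇒> W≰) | fuel
    ...   | X′ , inv′ , grown | zero   =
      contradiction (subst (_≤ n) grown (card-≤ X′))
                    (<⇒≱ (s≤s (subst (n ≤_) (+-identityʳ (card X)) room)))
    ...   | X′ , inv′ , grown | suc f  =
      go f X′ inv′ (subst (n ≤_) (trans (+-suc (card X) f) (cong (_+ f) (sym grown))) room)

module _ {n} (T : RootedTree n) (w : Fin n → ℕ) (W ∂W : ℕ)
         {S0 : Sub n} (hS0 : IsS0 T w W S0) {L : Sub n} (hL : IsL w ∂W S0 L) where
  private
    r = root T

  solution⇒L' : 0 < W → Σ (Sub n) (GoodS T w W ∂W) → Σ (Sub n) (GoodL' T w W ∂W S0 L)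
  solution⇒L' 0<W (S , W≤wS , wS≤ , r∈S , conS , light) =
    L' , L'⊆L , size ,
    (T' , T'-smallest , ≤-trans (wt-mono w T'⊆S) wS≤ , L'-exact) ,
    (rootComponent T Free , rootComponent-isComponent T (S⊆Free r r∈S) , ≤-trans W≤wS (wt-mono w S⊆T''))
    where
      S0⊆S : S0 ⊆ S
      S0⊆S = light⇒S0⊆ T w W hS0 r∈S conS light

      L' : Sub n
      L' = L ∩ S

      L'⊆L : L' ⊆ L
      L'⊆L u u∈L' = proj₁ (∩-elim L S u∈L')

      L'⊆S : L' ⊆ S
      L'⊆S u u∈L' = proj₂ (∩-elim L S u∈L')

      S0∪L'⊆S : (S0 ∪ L') ⊆ S
      S0∪L'⊆S u u∈ with ∪-cases S0 L' u∈
      ... | inj₁ u∈S0 = S0⊆S u u∈S0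
      ... | inj₂ u∈L' = L'⊆S u u∈L'

      T' : Sub n
      T' = upClosure T (S0 ∪ L')

      T'-smallest : IsSmallestSubtree T (S0 ∪ L') T'
      T'-smallest = upClosure-smallest T (∪-inj₁ S0 L' (root∈S0 T w W hS0))

      T'⊆S : T' ⊆ S
      T'⊆S = proj₂ (proj₂ T'-smallest) S S0∪L'⊆S conS

      L'-exact : ∀ u → (u ∈ L') ⇔ ((u ∈ L) × (u ∈ T'))
      L'-exact u = mk⇔ (λ u∈L' → L'⊆L u u∈L' , proj₁ T'-smallest u (∪-inj₂ S0 L' u∈L'))
                       (λ (u∈L , u∈T') → ∩-intro L S u∈L (T'⊆S u u∈T'))

      -- Every vertex of L' weighs more than ∂W, and all of them lie in S.
      size : card L' * ∂W < W + ∂W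
      size = count-bound (card L') ∂W (W + ∂W) (≤-trans 0<W (m≤m+n W ∂W)) (begin
        card L' * suc ∂W  ≤⟨ card-* w L' (suc ∂W) (λ u u∈L' → proj₂ (to (hL u) (L'⊆L u u∈L'))) ⟩
        wt w L'           ≤⟨ wt-mono w L'⊆S ⟩
        wt w S            ≤⟨ wS≤ ⟩
        W + ∂W            ∎)
        where open ≤-Reasoning

      Free : Sub n
      Free = complement (L ∖ L')

      S⊆Free : S ⊆ Free
      S⊆Free u u∈S = ∖-avoid⁺ L L' (λ u∈L → ∩-intro L S u∈L u∈S)

      S⊆T'' : S ⊆ rootComponent T Free
      S⊆T'' u u∈S =
        from (rootComponent-isComponent T (S⊆Free r r∈S) u) (reach-mono T S⊆Free (conS r u r∈S u∈S))

  L'⇒solution : Σ (Sub n) (GoodL' T w W ∂W S0 L) → Σ (Sub n) (GoodS T w W ∂W)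
  L'⇒solution (L' , _ , _ , (T' , (S0∪L'⊆T' , conT' , _) , wT'≤ , _) , (T'' , compT'' , W≤wT'')) =
    finish (grow w W Stage extend T' ((λ _ u∈ → u∈) , conT' , wT'≤))
    where
      S0⊆T' : S0 ⊆ T'
      S0⊆T' u u∈S0 = S0∪L'⊆T' u (∪-inj₁ S0 L' u∈S0)

      L'⊆T' : L' ⊆ T'
      L'⊆T' u u∈L' = S0∪L'⊆T' u (∪-inj₂ S0 L' u∈L')

      r∈T' : r ∈ T'
      r∈T' = S0⊆T' r (root∈S0 T w W hS0)

      Stage : Sub n → Set
      Stage X = (T' ⊆ X) × Connected T X × (wt w X ≤ W + ∂W)

      extend : ∀ X → Stage X → wt w X < W → Σ (Sub n) λ X′ → Stage X′ × card X′ ≡ suc (card X)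
      extend X (T'⊆X , conX , _) wX<W with extra-vertex w X T'' (<-≤-trans wX<W W≤wT'')
      ... | z , z∈T'' , z∉X with topmost-outside T X (T'⊆X r r∈T') z∉X
      ... | t , t∉X , Pt∈X , t≤z =
        ⁅ t ⁆ ∪ X , ((λ u u∈T' → ∪-inj₂ ⁅ t ⁆ X (T'⊆X u u∈T')) , insert-connected T conX t∉X Pt∈X , weight) ,
        wt-insert (λ _ → 1) X t t∉X
        where
          t≢r : t ≢ r
          t≢r t≡r = ∈-∉ (subst (_∈ X) (sym t≡r) (T'⊆X r r∈T')) t∉X

          -- the path in T'' from z to the root leaves the subtree of t through t
          t∈Free : t ∈ complement (L ∖ L')
          t∈Free = proj₁ (leave-subtree T t (reach-sym T (to (compT'' z) z∈T'')) t≤z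
                                         (λ t≤r → t≢r (desc-root T t≤r)))

          t∉L : t ∉ L
          t∉L = ∉-by-contra (λ t∈L → ∈-∉ (T'⊆X t (L'⊆T' t (∖-avoid⁻ L L' t∈Free t∈L))) t∉X)

          t∉S0 : t ∉ S0
          t∉S0 = ∉-by-contra (λ t∈S0 → ∈-∉ (T'⊆X t (S0⊆T' t t∈S0)) t∉X)

          light-t : w t ≤ ∂W
          light-t = ≮⇒≥ (λ heavy → ∈-∉ (from (hL t) (t∉S0 , heavy)) t∉L)

          weight : wt w (⁅ t ⁆ ∪ X) ≤ W + ∂W
          weight = begin
            wt w (⁅ t ⁆ ∪ X)  ≡⟨ wt-insert w X t t∉X ⟩
            w t + wt w X      ≤⟨ +-mono-≤ light-t (<⇒≤ wX<W) ⟩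
            ∂W + W            ≡⟨ +-comm ∂W W ⟩
            W + ∂W            ∎
            where open ≤-Reasoning

      finish : (Σ (Sub n) λ S → Stage S × W ≤ wt w S) → Σ (Sub n) (GoodS T w W ∂W)
      finish (S , (T'⊆S , conS , wS≤) , W≤wS) =
        S , W≤wS , wS≤ , r∈S , conS , S0⊆⇒light T w W hS0 r∈S conS (λ u u∈S0 → T'⊆S u (S0⊆T' u u∈S0))
        where
          r∈S : r ∈ S
          r∈S = T'⊆S r r∈T'

lemma1 : ∀ {n} (T : RootedTree n) (w : Fin n → ℕ) (W ∂W : ℕ) →
    0 < W → 0 < ∂W →
    (S0 : Sub n) → IsS0 T w W S0 →
    (L : Sub n) → IsL w ∂W S0 L →
    (Σ (Sub n) λ S → GoodS T w W ∂W S) ⇔ (Σ (Sub n) λ L' → GoodL' T w W ∂W S0 L L')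
lemma1 T w W ∂W 0<W _ S0 hS0 L hL =
  mk⇔ (solution⇒L' T w W ∂W hS0 hL 0<W) (L'⇒solution T w W ∂W hS0 hL)
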